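{- Let $(X,\odot,\ell,r)$ be an $\ell r$-multimagma. Then for all $x,y\in X$: \begin{enumerate} \item $\ell(r(x))=r(x)$, $r(\ell(x))=\ell(x)$, $\ell(\ell(x))=\ell(x)$, $r(r(x))=r(x)$; \item $\ell(x)\odot\ell(x)=\{\ell(x)\}$; \item $r(x)\odot\ell(y)=\ell(y)\odot r(x)$; \item $\ell(\ell(x)\odot y)=\ell(x)\odot\ell(y)$ and $r(x\odot r(y))=r(x)\odot r(y)$; \item $\ell(x\odot y)\odot x\subseteq x\odot\ell(y)$ and $x\odot r(y\odot x)\subseteq r(y)\odot x$. \end{enumerate}
   Context: A multimagma is a non-empty set $X$ with $\odot:X\times X\to\mathcal{P}X$, extended to subsets by $A\odot B=\bigcup\{a\odot b\mid a\in A,b\in B\}$ (and $x\odot B=\{x\}\odot B$, $A\odot x=A\odot\{x\}$). $D_{xy}$ means $x\odot y\neq\emptyset$. An $\ell r$-multimagma is a multimagma with maps $\ell,r:X\to X$ such that for all $x,y$: $D_{xy}\Rightarrow r(x)=\ell(y)$, $\ell(x)\odot x=\{x\}$, $x\odot r(x)=\{x\}$. For $A\subseteq X$, $\ell(A)=\{\ell(a)\mid a\in A\}$, $r(A)=\{r(a)\mid a\in A\}$. -}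

module Defs where

open import Level using (Level; _⊔_; suc)
open import Data.Product using (Σ; ∃; ∃-syntax; _×_; _,_)
open import Relation.Binary.PropositionalEquality using (_≡_)
open import Relation.Nullary using (¬_)

Subset : ∀ {a} → Set a → Set (suc a)
Subset {a} X = X → Set a

module _ {a} {X : Set a} where

  _∈_ : X → Subset X → Set a
  x ∈ A = A x

  _⊆_ : Subset X → Subset X → Set a
  A ⊆ B = ∀ z → z ∈ A → z ∈ B

  _≐_ : Subset X → Subset X → Set a
  A ≐ B = (A ⊆ B) × (B ⊆ A)

  ｛_｝ : X → Subset X
  ｛ x ｝ z = z ≡ x

  image : (X → X) → Subset X → Subset X
  image f A z = ∃[ a ] (a ∈ A × f a ≡ z)

record Multimagma a : Set (suc a) where
  field
    Carrier : Set a
    inhabitant : Carrier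
    _⊙_ : Carrier → Carrier → Subset Carrier

  _⊙ˢ_ : Subset Carrier → Subset Carrier → Subset Carrier
  (A ⊙ˢ B) z = ∃[ x ] ∃[ y ] (x ∈ A × y ∈ B × z ∈ (x ⊙ y))

  _⊙ₑ_ : Carrier → Subset Carrier → Subset Carrier
  x ⊙ₑ B = ｛ x ｝ ⊙ˢ B

  _ₑ⊙_ : Subset Carrier → Carrier → Subset Carrier
  A ₑ⊙ x = A ⊙ˢ ｛ x ｝

  D : Carrier → Carrier → Set a
  D x y = ∃[ z ] (z ∈ (x ⊙ y))

record LRMultimagma a : Set (suc a) where
  field
    multimagma : Multimagma a
  open Multimagma multimagma public
  field
    ℓ : Carrier → Carrier
    r : Carrier → Carrier
    D⇒r≡ℓ : ∀ x y → D x y → r x ≡ ℓ y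
    ℓ-unit : ∀ x → (ℓ x ⊙ x) ≐ ｛ x ｝
    r-unit : ∀ x → (x ⊙ r x) ≐ ｛ x ｝

{-# OPTIONS --safe #-}
-- Fixed points of r, such as every ℓ x, are rigid left units: if e ⊙ y is
-- non-empty and r e ≡ e, then e ≡ r e ≡ ℓ y, hence e ⊙ y ⊆ {y}. All the
-- identities follow from this rigidity, and each statement about r is the
-- corresponding statement about ℓ in the opposite multimagma.
module Submission where

open import Defs
open import Data.Product using (_×_; _,_; proj₁; proj₂)
open import Function using (flip)
open import Relation.Binary.PropositionalEquality using (_≡_; refl; sym; trans; subst)

opposite : ∀ {a} → LRMultimagma a → LRMultimagma a
opposite M = record
  { multimagma = record { Carrier = Carrier ; inhabitant = inhabitant ; _⊙_ = flip _⊙_ }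
  ; ℓ = r
  ; r = ℓ
  ; D⇒r≡ℓ = λ x y d → sym (D⇒r≡ℓ y x d)
  ; ℓ-unit = r-unit
  ; r-unit = ℓ-unit
  }
  where open LRMultimagma M

module LeftUnitProperties {a} (M : LRMultimagma a) where
  open LRMultimagma M

  ∈ℓ⊙ : ∀ x → x ∈ (ℓ x ⊙ x)
  ∈ℓ⊙ x = proj₂ (ℓ-unit x) x refl

  ∈⊙r : ∀ x → x ∈ (x ⊙ r x)
  ∈⊙r x = proj₂ (r-unit x) x refl

  r∘ℓ : ∀ x → r (ℓ x) ≡ ℓ x
  r∘ℓ x = D⇒r≡ℓ (ℓ x) x (x , ∈ℓ⊙ x)

  ℓ⊙ℓ : ∀ x → (ℓ x ⊙ ℓ x) ≐ ｛ ℓ x ｝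
  ℓ⊙ℓ x = subst (λ t → (ℓ x ⊙ t) ≐ ｛ ℓ x ｝) (r∘ℓ x) (r-unit (ℓ x))

  r-fixed-D⇒≡ℓ : ∀ {e y} → r e ≡ e → D e y → e ≡ ℓ y
  r-fixed-D⇒≡ℓ {e} {y} re d = trans (sym re) (D⇒r≡ℓ e y d)

  r-fixed-⊙⊆ : ∀ {e y} → r e ≡ e → (e ⊙ y) ⊆ ｛ y ｝
  r-fixed-⊙⊆ {y = y} re z z∈e⊙y with refl ← r-fixed-D⇒≡ℓ re (z , z∈e⊙y) =
    proj₁ (ℓ-unit y) z z∈e⊙y

  ℓ∘ℓ : ∀ x → ℓ (ℓ x) ≡ ℓ x
  ℓ∘ℓ x = sym (r-fixed-D⇒≡ℓ (r∘ℓ x) (ℓ x , proj₂ (ℓ⊙ℓ x) (ℓ x) refl))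

  ℓ-D⇒≡ : ∀ {x y} → D (ℓ x) y → ℓ x ≡ ℓ y
  ℓ-D⇒≡ {x} = r-fixed-D⇒≡ℓ (r∘ℓ x)

  ≡⇒⊙-comm : ∀ {e f} → e ≡ f → (e ⊙ f) ⊆ (f ⊙ e)
  ≡⇒⊙-comm refl z z∈e⊙e = z∈e⊙e

  image-ℓ-ℓ⊙ : ∀ x y → image ℓ (ℓ x ⊙ y) ≐ (ℓ x ⊙ ℓ y)
  image-ℓ-ℓ⊙ x y = ⊆-to , ⊆-from
    where
    ⊆-to : image ℓ (ℓ x ⊙ y) ⊆ (ℓ x ⊙ ℓ y)
    ⊆-to _ (z , z∈ℓx⊙y , refl) with refl ← r-fixed-⊙⊆ (r∘ℓ x) z z∈ℓx⊙y =
      subst (λ t → ℓ z ∈ (t ⊙ ℓ z)) (sym (ℓ-D⇒≡ (z , z∈ℓx⊙y)))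
            (proj₂ (ℓ⊙ℓ z) (ℓ z) refl)

    ⊆-from : (ℓ x ⊙ ℓ y) ⊆ image ℓ (ℓ x ⊙ y)
    ⊆-from w w∈ℓx⊙ℓy =
      y , subst (λ t → y ∈ (t ⊙ y)) (sym ℓx≡ℓy) (∈ℓ⊙ y)
        , sym (r-fixed-⊙⊆ (r∘ℓ x) w w∈ℓx⊙ℓy)
      where
      ℓx≡ℓy : ℓ x ≡ ℓ y
      ℓx≡ℓy = trans (ℓ-D⇒≡ (w , w∈ℓx⊙ℓy)) (ℓ∘ℓ y)

  image-ℓ-⊙ₑ⊆ : ∀ x y → (image ℓ (x ⊙ y) ₑ⊙ x) ⊆ (x ⊙ ℓ y)
  image-ℓ-⊙ₑ⊆ x y w (_ , _ , (z , z∈x⊙y , refl) , refl , w∈ℓz⊙x)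
    with refl ← r-fixed-⊙⊆ (r∘ℓ z) w w∈ℓz⊙x =
    subst (λ t → w ∈ (w ⊙ t)) (D⇒r≡ℓ w y (z , z∈x⊙y)) (∈⊙r w)

module Properties {a} (M : LRMultimagma a) where
  open LRMultimagma M
  open LeftUnitProperties M public
  private
    module Dual = LeftUnitProperties (opposite M)

  ℓ∘r : ∀ x → ℓ (r x) ≡ r x
  ℓ∘r = Dual.r∘ℓ

  r∘r : ∀ x → r (r x) ≡ r x
  r∘r = Dual.ℓ∘ℓ

  r⊙ℓ-comm : ∀ x y → (r x ⊙ ℓ y) ≐ (ℓ y ⊙ r x)
  r⊙ℓ-comm x y = comm (r∘r x) (ℓ∘ℓ y) , comm (r∘ℓ y) (ℓ∘r x)
    where
    comm : ∀ {e f} → r e ≡ e → ℓ f ≡ f → (e ⊙ f) ⊆ (f ⊙ e)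
    comm re lf z z∈e⊙f = ≡⇒⊙-comm (trans (r-fixed-D⇒≡ℓ re (z , z∈e⊙f)) lf) z z∈e⊙f

  image-r-⊙r : ∀ x y → image r (x ⊙ r y) ≐ (r x ⊙ r y)
  image-r-⊙r x y = Dual.image-ℓ-ℓ⊙ y x

  ⊙ₑ-image-r⊆ : ∀ x y → (x ⊙ₑ image r (y ⊙ x)) ⊆ (r y ⊙ x)
  ⊙ₑ-image-r⊆ x y w (x′ , y′ , x′∈ , y′∈ , w∈) = Dual.image-ℓ-⊙ₑ⊆ x y w (y′ , x′ , y′∈ , x′∈ , w∈)

lemma3p1 : ∀ {a} (M : LRMultimagma a) → let open LRMultimagma M in
    ∀ x y →
      -- (1)
      ((ℓ (r x) ≡ r x) × (r (ℓ x) ≡ ℓ x) × (ℓ (ℓ x) ≡ ℓ x) × (r (r x) ≡ r x))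
      -- (2)
      × ((ℓ x ⊙ ℓ x) ≐ ｛ ℓ x ｝)
      -- (3)
      × ((r x ⊙ ℓ y) ≐ (ℓ y ⊙ r x))
      -- (4)
      × ((image ℓ (ℓ x ⊙ y) ≐ (ℓ x ⊙ ℓ y)) × (image r (x ⊙ r y) ≐ (r x ⊙ r y)))
      -- (5)
      × (((image ℓ (x ⊙ y) ₑ⊙ x) ⊆ (x ⊙ ℓ y))
         × ((x ⊙ₑ image r (y ⊙ x)) ⊆ (r y ⊙ x)))
lemma3p1 M x y =
    (ℓ∘r x , r∘ℓ x , ℓ∘ℓ x , r∘r x)
  , ℓ⊙ℓ x
  , r⊙ℓ-comm x y
  , (image-ℓ-ℓ⊙ x y , image-r-⊙r x y)
  , (image-ℓ-⊙ₑ⊆ x y , ⊙ₑ-image-r⊆ x y)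
  where open Properties M
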